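{- Let $p\equiv 1\pmod 4$ be a prime and $q\in\mathbb{Z}_p$ with $q^2\equiv -1\pmod p$. Let $N=\mathbb{Z}_p$ and $\Gamma=\mathrm{BiCay}(N,\emptyset,\emptyset,S)$ with $S=\{\pm1,\pm q\}$ and vertex set $N_0\cup N_1$. Let $\delta$ be the permutation of the vertices given by $(x)_\varepsilon\mapsto (xq)_{1-\varepsilon}$ for $x\in\mathbb{Z}_p$, $\varepsilon\in\{0,1\}$, and let $G:=N\rtimes\langle\delta\rangle$, where $N$ acts by $(x)_\varepsilon\mapsto(x+n)_\varepsilon$. Then $\Gamma$ is connected and $4$-valent, $G\le\mathrm{Aut}(\Gamma)$, $\Gamma$ is $G$-oriented, $(\Gamma,G)$ is basic of biquasiprimitive type, and $\mathrm{soc}(G)=N\cong C_p$ is abelian (so $(\Gamma,G)$ falls into the abelian case with $k=1$).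
   Context: For a group $N$ (here written additively) and subsets $R,L,S\subseteq N$, $\mathrm{BiCay}(N,R,L,S)$ is the graph with vertex set $N_0\cup N_1$ (two copies $\{h_0\},\{h_1\}$ of $N$), with edges $\{h_0,g_0\}$ for $g-h\in R$, $\{h_1,g_1\}$ for $g-h\in L$, and $\{h_0,g_1\}$ for $g-h\in S$. $\Gamma$ is $G$-oriented if $G\le\mathrm{Aut}(\Gamma)$ is transitive on vertices and edges but not on arcs. $(\Gamma,G)$ is basic of biquasiprimitive type if every nontrivial normal subgroup of $G$ has at most two vertex-orbits and some has exactly two. -}

module Defs where

open import Level using (Level; 0ℓ) renaming (suc to lsuc)
open import Data.Nat using (ℕ; NonZero; _+_; _*_; _∸_)
open import Data.Nat.DivMod using (_mod_)
open import Data.Fin using (Fin; toℕ)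
open import Data.Bool using (Bool; true; false; not)
open import Data.Product using (Σ; ∃; _×_; _,_)
open import Data.Sum using (_⊎_)
open import Data.Empty using (⊥)
open import Data.List using (List; length)
open import Data.List.Relation.Unary.Unique.Propositional using (Unique)
open import Data.List.Membership.Propositional using (_∈_)
open import Function using (_∘_; id)
open import Function.Bundles using (_⇔_)
open import Relation.Nullary using (¬_)
open import Relation.Binary.PropositionalEquality using (_≡_; _≗_)

module Zmod (p : ℕ) {{nz : NonZero p}} where

  Zp : Set
  Zp = Fin p

  infixl 6 _+ₚ_ _-ₚ_
  infixl 7 _*ₚ_

  _+ₚ_ : Zp → Zp → Zp
  x +ₚ y = (toℕ x + toℕ y) mod p

  _*ₚ_ : Zp → Zp → Zp
  x *ₚ y = (toℕ x * toℕ y) mod p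

  -ₚ_ : Zp → Zp
  -ₚ x = (p ∸ toℕ x) mod p

  _-ₚ_ : Zp → Zp → Zp
  x -ₚ y = x +ₚ (-ₚ y)

  1ₚ : Zp
  1ₚ = 1 mod p

-- Bi-Cayley graphs over ℤ_p.  Vertex (h , false) is h_0, (h , true) is h_1.

module BiCay (p : ℕ) {{nz : NonZero p}} where
  open Zmod p

  Vertex : Set
  Vertex = Zp × Bool

  Adj : (R L S : Zp → Set) → Vertex → Vertex → Set
  Adj R L S (h , false) (g , false) = R (g -ₚ h)
  Adj R L S (h , true)  (g , true)  = L (g -ₚ h)
  Adj R L S (h , false) (g , true)  = S (g -ₚ h)
  Adj R L S (h , true)  (g , false) = S (h -ₚ g)

module GraphGroup {V : Set} (Adj : V → V → Set) where

  Perm : Set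
  Perm = V → V

  data Walk : V → V → Set where
    here : ∀ {u} → Walk u u
    step : ∀ {u v w} → Adj u v → Walk v w → Walk u w

  Connected : Set
  Connected = ∀ u v → Walk u v

  Regular : ℕ → Set
  Regular k = ∀ v → Σ (List V) λ ws →
    length ws ≡ k × Unique ws × (∀ w → Adj v w ⇔ (w ∈ ws))

  IsAut : Perm → Set
  IsAut f = (Σ Perm λ g → (g ∘ f ≗ id) × (f ∘ g ≗ id))
          × (∀ u v → Adj u v ⇔ Adj (f u) (f v))

  module OverGroup (G : Perm → Set) where

    SubgroupOfAut : Set
    SubgroupOfAut = ∀ f → G f → IsAut f

    VertexTransitive : Set
    VertexTransitive = ∀ u v → Σ Perm λ g → G g × g u ≡ v

    EdgeTransitive : Set
    EdgeTransitive = ∀ u v u' v' → Adj u v → Adj u' v' →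
      Σ Perm λ g → G g × ((g u ≡ u' × g v ≡ v') ⊎ (g u ≡ v' × g v ≡ u'))

    ArcTransitive : Set
    ArcTransitive = ∀ u v u' v' → Adj u v → Adj u' v' →
      Σ Perm λ g → G g × g u ≡ u' × g v ≡ v'

    Oriented : Set
    Oriented = VertexTransitive × EdgeTransitive × ¬ ArcTransitive

    -- H is a subgroup of G (subsets of permutations, up to pointwise equality)
    record IsSubgroup (H : Perm → Set) : Set where
      field
        sub   : ∀ {f} → H f → G f
        resp  : ∀ {f g} → H f → f ≗ g → H g
        h-id  : H id
        h-∘   : ∀ {f g} → H f → H g → H (f ∘ g)
        h-inv : ∀ {f} → H f → Σ Perm λ g → H g × (g ∘ f ≗ id) × (f ∘ g ≗ id)

    IsNormal : (Perm → Set) → Set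
    IsNormal H = IsSubgroup H ×
      (∀ g g' f → G g → G g' → (g' ∘ g ≗ id) → (g ∘ g' ≗ id) → H f → H (g ∘ f ∘ g'))

    Nontrivial : (Perm → Set) → Set
    Nontrivial H = Σ Perm λ f → H f × ¬ (f ≗ id)

    Orbit : (Perm → Set) → V → V → Set
    Orbit H u v = Σ Perm λ h → H h × h u ≡ v

    AtMostTwoOrbits : (Perm → Set) → Set
    AtMostTwoOrbits H = Σ V λ u₁ → Σ V λ u₂ → ∀ v → Orbit H u₁ v ⊎ Orbit H u₂ v

    OneOrbit : (Perm → Set) → Set
    OneOrbit H = Σ V λ u → ∀ v → Orbit H u v

    ExactlyTwoOrbits : (Perm → Set) → Set
    ExactlyTwoOrbits H = AtMostTwoOrbits H × ¬ OneOrbit H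

    BasicBiquasiprimitive : Set₁
    BasicBiquasiprimitive =
      (∀ H → IsNormal H → Nontrivial H → AtMostTwoOrbits H)
      × (Σ (Perm → Set) λ H → IsNormal H × Nontrivial H × ExactlyTwoOrbits H)

    MinimalNormal : (Perm → Set) → Set₁
    MinimalNormal M = IsNormal M × Nontrivial M ×
      (∀ K → IsNormal K → Nontrivial K → (∀ f → K f → M f) → ∀ f → M f → K f)

    data InSoc : Perm → Set₁ where
      s-min : ∀ M {f} → MinimalNormal M → M f → InSoc f
      s-id  : InSoc id
      s-∘   : ∀ {f g} → InSoc f → InSoc g → InSoc (f ∘ g)
      s-inv : ∀ {f g} → InSoc f → (g ∘ f ≗ id) → (f ∘ g ≗ id) → InSoc g
      s-≗   : ∀ {f g} → InSoc f → f ≗ g → InSoc g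

module Example (p : ℕ) {{nz : NonZero p}} (q : Fin p) where
  open Zmod p public
  open BiCay p public

  S : Zp → Set
  S x = x ≡ 1ₚ ⊎ x ≡ -ₚ 1ₚ ⊎ x ≡ q ⊎ x ≡ -ₚ q

  ∅ : Zp → Set
  ∅ _ = ⊥

  Γ : Vertex → Vertex → Set
  Γ = Adj ∅ ∅ S

  open GraphGroup Γ public

  τ : Zp → Perm
  τ n (x , ε) = (x +ₚ n , ε)

  δ : Perm
  δ (x , ε) = (x *ₚ q , not ε)

  InN : Perm → Set
  InN f = Σ Zp λ n → f ≗ τ n

  data InG : Perm → Set where
    g-id : InG id
    g-τ  : ∀ n → InG (τ n)
    g-δ  : InG δ
    g-∘  : ∀ {f g} → InG f → InG g → InG (f ∘ g)
    g-≗  : ∀ {f g} → InG f → f ≗ g → InG g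

  open OverGroup InG public

-- Every element of G = ⟨N, δ⟩ is an affine map xε ↦ (x u + n)ε⊕b with (b, u) = (0, ±1) or (1, ±q),
-- the multipliers forming the cyclic group ⟨q⟩ of order 4. Orienting each edge from N₀ to N₁ when
-- its difference is ±1 and from N₁ to N₀ when it is ±q is G-invariant, and G is transitive on these
-- arcs: so G is transitive on vertices and edges, but nothing in G reverses the arc 0₀ → 1₁.
-- An element of a normal subgroup with multiplier u ≠ 1 has commutator τ(1 - u) with τ 1, and since
-- p is prime any nontrivial translation generates N. Hence every nontrivial normal subgroup contains
-- N, whose orbits are N₀ and N₁, and N is the socle. Γ is connected because the walk
-- h₀ → (h + 1)₁ → (h + 2)₀ shifts by 2, which generates ℤₚ as p is odd.

module Submission where

open import Defs
open import Data.Nat using (ℕ; zero; suc; NonZero; ≢-nonZero; _%_; _<_; s≤s; z≤n)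
import Data.Nat as Nat
import Data.Nat.Properties as ℕₚ
open import Data.Nat.DivMod
  using (_mod_; [m+kn]%n≡m%n; m%n<n; %-distribˡ-+; %-distribˡ-*; m<n⇒m%n≡m; n%n≡0; m*n%n≡0)
open import Data.Fin using (Fin; toℕ; _≟_)
open import Data.Fin.Properties using (toℕ-injective; toℕ-fromℕ<; toℕ<n)
open import Algebra.Bundles using (CommutativeRing)
open import Algebra.Structures using (IsCommutativeRing)
open import Tactic.RingSolver using (solve-∀)
open import Tactic.RingSolver.Core.AlmostCommutativeRing
  using (AlmostCommutativeRing; module AlmostCommutativeRing; fromCommutativeRing)
open import Data.Maybe using (nothing)
open import Data.Bool using (Bool; true; false; not; _xor_)
open import Data.Bool.Properties using (xor-assoc; xor-comm; xor-identityʳ; not-involutive; not-¬)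
open import Relation.Binary.PropositionalEquality hiding (resp)
open import Data.Nat.Primality using (Prime; ¬prime[0]; ¬prime[1])
open import Data.Empty using (⊥-elim)
open import Data.Sum using (_⊎_; inj₁; inj₂; assocˡ; assocʳ)
import Data.Sum as Sum
open import Data.Nat.Coprimality using (prime⇒coprime; coprime-Bézout)
open import Data.Nat.GCD using (module Bézout)
open import Data.Product using (Σ; ∃; _×_; _,_; proj₁; proj₂)
import Data.Product as Σ
open import Data.List using (List; []; _∷_; length; map)
open import Data.List.Relation.Unary.Any using (here; there)
open import Data.List.Relation.Unary.AllPairs using ([]; _∷_)
open import Data.List.Relation.Unary.All using ([]; _∷_)
open import Data.List.Properties using (length-map)
open import Data.List.Membership.Propositional using (_∈_)
open import Data.List.Membership.Propositional.Properties using (∈-map⁺; ∈-map⁻)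
open import Data.List.Relation.Unary.Unique.Propositional using (Unique)
open import Data.List.Relation.Unary.Unique.Propositional.Properties using (map⁺)
open import Function using (_∘_; id)
open import Function.Bundles using (_⇔_; mk⇔; Equivalence)
open import Relation.Nullary using (¬_; yes; no)

module ZmodRing (p : ℕ) {{nz : NonZero p}} where
  open Zmod p
  open Nat using (_+_; _*_; _∸_)

  0ₚ : Zp
  0ₚ = 0 mod p

  toℕ-mod : ∀ m → toℕ (m mod p) ≡ m % p
  toℕ-mod m = toℕ-fromℕ< (m%n<n m p)

  mod-cong : ∀ {m n} → m % p ≡ n % p → m mod p ≡ n mod p
  mod-cong {m} {n} e = toℕ-injective (trans (toℕ-mod m) (trans e (sym (toℕ-mod n))))

  mod-toℕ : ∀ x → toℕ x mod p ≡ x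
  mod-toℕ x = toℕ-injective (trans (toℕ-mod (toℕ x)) (m<n⇒m%n≡m (toℕ<n x)))

  +ₚ-homo : ∀ m n → (m mod p) +ₚ (n mod p) ≡ (m + n) mod p
  +ₚ-homo m n = mod-cong (begin
    (toℕ (m mod p) + toℕ (n mod p)) % p ≡⟨ cong₂ (λ a b → (a + b) % p) (toℕ-mod m) (toℕ-mod n) ⟩
    (m % p + n % p) % p                 ≡⟨ %-distribˡ-+ m n p ⟨
    (m + n) % p                         ∎)
    where open ≡-Reasoning

  *ₚ-homo : ∀ m n → (m mod p) *ₚ (n mod p) ≡ (m * n) mod p
  *ₚ-homo m n = mod-cong (begin
    (toℕ (m mod p) * toℕ (n mod p)) % p ≡⟨ cong₂ (λ a b → (a * b) % p) (toℕ-mod m) (toℕ-mod n) ⟩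
    (m % p * (n % p)) % p               ≡⟨ %-distribˡ-* m n p ⟨
    (m * n) % p                         ∎)
    where open ≡-Reasoning

  private
    ⟦_⟧ : Zp → ℕ
    ⟦_⟧ = toℕ

  +ₚ-assoc : ∀ x y z → (x +ₚ y) +ₚ z ≡ x +ₚ (y +ₚ z)
  +ₚ-assoc x y z = begin
    (x +ₚ y) +ₚ z                     ≡⟨ cong ((x +ₚ y) +ₚ_) (mod-toℕ z) ⟨
    (x +ₚ y) +ₚ (⟦ z ⟧ mod p)          ≡⟨ +ₚ-homo (⟦ x ⟧ + ⟦ y ⟧) ⟦ z ⟧ ⟩
    (⟦ x ⟧ + ⟦ y ⟧ + ⟦ z ⟧) mod p      ≡⟨ cong (_mod p) (ℕₚ.+-assoc ⟦ x ⟧ ⟦ y ⟧ ⟦ z ⟧) ⟩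
    (⟦ x ⟧ + (⟦ y ⟧ + ⟦ z ⟧)) mod p    ≡⟨ +ₚ-homo ⟦ x ⟧ (⟦ y ⟧ + ⟦ z ⟧) ⟨
    (⟦ x ⟧ mod p) +ₚ (y +ₚ z)          ≡⟨ cong (_+ₚ (y +ₚ z)) (mod-toℕ x) ⟩
    x +ₚ (y +ₚ z)                     ∎
    where open ≡-Reasoning

  *ₚ-assoc : ∀ x y z → (x *ₚ y) *ₚ z ≡ x *ₚ (y *ₚ z)
  *ₚ-assoc x y z = begin
    (x *ₚ y) *ₚ z                     ≡⟨ cong ((x *ₚ y) *ₚ_) (mod-toℕ z) ⟨
    (x *ₚ y) *ₚ (⟦ z ⟧ mod p)          ≡⟨ *ₚ-homo (⟦ x ⟧ * ⟦ y ⟧) ⟦ z ⟧ ⟩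
    (⟦ x ⟧ * ⟦ y ⟧ * ⟦ z ⟧) mod p      ≡⟨ cong (_mod p) (ℕₚ.*-assoc ⟦ x ⟧ ⟦ y ⟧ ⟦ z ⟧) ⟩
    (⟦ x ⟧ * (⟦ y ⟧ * ⟦ z ⟧)) mod p    ≡⟨ *ₚ-homo ⟦ x ⟧ (⟦ y ⟧ * ⟦ z ⟧) ⟨
    (⟦ x ⟧ mod p) *ₚ (y *ₚ z)          ≡⟨ cong (_*ₚ (y *ₚ z)) (mod-toℕ x) ⟩
    x *ₚ (y *ₚ z)                     ∎
    where open ≡-Reasoning

  *ₚ-distribˡ-+ₚ : ∀ x y z → x *ₚ (y +ₚ z) ≡ x *ₚ y +ₚ x *ₚ z
  *ₚ-distribˡ-+ₚ x y z = begin
    x *ₚ (y +ₚ z)                        ≡⟨ cong (_*ₚ (y +ₚ z)) (mod-toℕ x) ⟨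
    (⟦ x ⟧ mod p) *ₚ (y +ₚ z)             ≡⟨ *ₚ-homo ⟦ x ⟧ (⟦ y ⟧ + ⟦ z ⟧) ⟩
    (⟦ x ⟧ * (⟦ y ⟧ + ⟦ z ⟧)) mod p       ≡⟨ cong (_mod p) (ℕₚ.*-distribˡ-+ ⟦ x ⟧ ⟦ y ⟧ ⟦ z ⟧) ⟩
    (⟦ x ⟧ * ⟦ y ⟧ + ⟦ x ⟧ * ⟦ z ⟧) mod p ≡⟨ +ₚ-homo (⟦ x ⟧ * ⟦ y ⟧) (⟦ x ⟧ * ⟦ z ⟧) ⟨
    x *ₚ y +ₚ x *ₚ z                     ∎
    where open ≡-Reasoning

  +ₚ-comm : ∀ x y → x +ₚ y ≡ y +ₚ x
  +ₚ-comm x y = cong (_mod p) (ℕₚ.+-comm ⟦ x ⟧ ⟦ y ⟧)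

  *ₚ-comm : ∀ x y → x *ₚ y ≡ y *ₚ x
  *ₚ-comm x y = cong (_mod p) (ℕₚ.*-comm ⟦ x ⟧ ⟦ y ⟧)

  +ₚ-identityˡ : ∀ x → 0ₚ +ₚ x ≡ x
  +ₚ-identityˡ x = trans (cong (0ₚ +ₚ_) (sym (mod-toℕ x))) (trans (+ₚ-homo 0 ⟦ x ⟧) (mod-toℕ x))

  *ₚ-identityˡ : ∀ x → 1ₚ *ₚ x ≡ x
  *ₚ-identityˡ x = begin
    1ₚ *ₚ x              ≡⟨ cong (1ₚ *ₚ_) (mod-toℕ x) ⟨
    1ₚ *ₚ (⟦ x ⟧ mod p)   ≡⟨ *ₚ-homo 1 ⟦ x ⟧ ⟩
    (1 * ⟦ x ⟧) mod p     ≡⟨ cong (_mod p) (ℕₚ.*-identityˡ ⟦ x ⟧) ⟩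
    ⟦ x ⟧ mod p           ≡⟨ mod-toℕ x ⟩
    x                    ∎
    where open ≡-Reasoning

  -ₚ-inverseˡ : ∀ x → (-ₚ x) +ₚ x ≡ 0ₚ
  -ₚ-inverseˡ x = begin
    (-ₚ x) +ₚ x                 ≡⟨ cong ((-ₚ x) +ₚ_) (mod-toℕ x) ⟨
    (-ₚ x) +ₚ (⟦ x ⟧ mod p)      ≡⟨ +ₚ-homo (p ∸ ⟦ x ⟧) ⟦ x ⟧ ⟩
    (p ∸ ⟦ x ⟧ + ⟦ x ⟧) mod p    ≡⟨ cong (_mod p) (ℕₚ.m∸n+n≡m (ℕₚ.<⇒≤ (toℕ<n x))) ⟩
    p mod p                     ≡⟨ mod-cong (trans (n%n≡0 p) (sym (m*n%n≡0 0 p))) ⟩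
    0ₚ                          ∎
    where open ≡-Reasoning

  isCommutativeRing : IsCommutativeRing _≡_ _+ₚ_ _*ₚ_ (λ x → -ₚ x) 0ₚ 1ₚ
  isCommutativeRing = record
    { isRing = record
      { +-isAbelianGroup = record
        { isGroup = record
          { isMonoid = record
            { isSemigroup = record
              { isMagma = record { isEquivalence = isEquivalence ; ∙-cong = cong₂ _+ₚ_ }
              ; assoc = +ₚ-assoc }
            ; identity = +ₚ-identityˡ , λ x → trans (+ₚ-comm x 0ₚ) (+ₚ-identityˡ x) }
          ; inverse = -ₚ-inverseˡ , λ x → trans (+ₚ-comm x (-ₚ x)) (-ₚ-inverseˡ x)
          ; ⁻¹-cong = cong (λ x → -ₚ x) }
        ; comm = +ₚ-comm }
      ; *-cong = cong₂ _*ₚ_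
      ; *-assoc = *ₚ-assoc
      ; *-identity = *ₚ-identityˡ , λ x → trans (*ₚ-comm x 1ₚ) (*ₚ-identityˡ x)
      ; distrib = *ₚ-distribˡ-+ₚ , λ x y z → trans (*ₚ-comm (y +ₚ z) x)
                    (trans (*ₚ-distribˡ-+ₚ x y z) (cong₂ _+ₚ_ (*ₚ-comm x y) (*ₚ-comm x z))) }
    ; *-comm = *ₚ-comm }

  commutativeRing : CommutativeRing _ _
  commutativeRing = record { isCommutativeRing = isCommutativeRing }

  -- Tactic.RingSolver only recognises the operations of this bundle, which unfold to _+ₚ_, _*ₚ_ and
  -- -ₚ_; hence Notation below. Without a zero test it cannot normalise constants or negations, so it
  -- is only used for identities built from variables, _+_ and _*_.
  almostCommutativeRing : AlmostCommutativeRing _ _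
  almostCommutativeRing = fromCommutativeRing commutativeRing (λ _ → nothing)

  module Notation where
    open AlmostCommutativeRing almostCommutativeRing public using (_+_; _*_; -_; 0#; 1#)

  open import Algebra.Properties.Semiring.Mult (CommutativeRing.semiring commutativeRing) public
    using (×-assoc-*) renaming (_×_ to _·_)

  2<p⇒1+1≢0 : 2 < p → 1ₚ +ₚ 1ₚ ≢ 0ₚ
  2<p⇒1+1≢0 2<p 1+1≡0 = ℕₚ.1+n≢0 (begin
    2              ≡⟨ m<n⇒m%n≡m 2<p ⟨
    2 % p          ≡⟨ toℕ-mod 2 ⟨
    toℕ (2 mod p)  ≡⟨ cong toℕ (trans (sym (+ₚ-homo 1 1)) 1+1≡0) ⟩
    toℕ 0ₚ         ≡⟨ toℕ-mod 0 ⟩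
    0 % p          ≡⟨ m*n%n≡0 0 p ⟩
    0              ∎)
    where open ≡-Reasoning

  ·1≡mod : ∀ k → k · 1ₚ ≡ k mod p
  ·1≡mod zero    = refl
  ·1≡mod (suc k) = trans (cong (1ₚ +ₚ_) (·1≡mod k)) (+ₚ-homo 1 k)

module ZmodPrime (p : ℕ) {{nz : NonZero p}} (p-prime : Prime p) where
  open ZmodRing p
  open Notation
  open CommutativeRing commutativeRing using (*-assoc; *-identityˡ; *-identityʳ)
  open import Algebra.Properties.Ring (CommutativeRing.ring commutativeRing)
    using (-‿involutive; -‿distribˡ-*; +-inverseʳ-unique)

  nonzero⇒invertible : ∀ {t} → t ≢ 0# → ∃ λ w → w * t ≡ 1#
  nonzero⇒invertible {t} t≢0 =
    invert (coprime-Bézout (prime⇒coprime p-prime {{≢-nonZero ⟦t⟧≢0}} (toℕ<n t)))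
    where
    ⟦t⟧ : ℕ
    ⟦t⟧ = toℕ t
    ⟦t⟧≢0 : ⟦t⟧ ≢ 0
    ⟦t⟧≢0 e = t≢0 (trans (sym (mod-toℕ t)) (cong (_mod p) e))
    reduce : ∀ y → (y mod p) * t ≡ (y Nat.* ⟦t⟧) mod p
    reduce y = trans (cong ((y mod p) *_) (sym (mod-toℕ t))) (*ₚ-homo y ⟦t⟧)
    invert : Bézout.Identity 1 p ⟦t⟧ → ∃ λ w → w * t ≡ 1#
    invert (Bézout.+- x y eq) = - (y mod p) , (begin
      - (y mod p) * t   ≡⟨ -‿distribˡ-* (y mod p) t ⟨
      - ((y mod p) * t) ≡⟨ cong -_ (+-inverseʳ-unique 1# _ 1+yt≡0) ⟩
      - - 1#            ≡⟨ -‿involutive 1# ⟩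
      1#                ∎)
      where
      open ≡-Reasoning
      1+yt≡0 : 1# + (y mod p) * t ≡ 0#
      1+yt≡0 = begin
        1# + (y mod p) * t           ≡⟨ cong (1# +_) (reduce y) ⟩
        1# + (y Nat.* ⟦t⟧) mod p     ≡⟨ +ₚ-homo 1 (y Nat.* ⟦t⟧) ⟩
        (1 Nat.+ y Nat.* ⟦t⟧) mod p  ≡⟨ cong (_mod p) eq ⟩
        (x Nat.* p) mod p            ≡⟨ mod-cong ([m+kn]%n≡m%n 0 x p) ⟩
        0#                           ∎
    invert (Bézout.-+ x y eq) = y mod p , (begin
      (y mod p) * t              ≡⟨ reduce y ⟩
      (y Nat.* ⟦t⟧) mod p        ≡⟨ cong (_mod p) eq ⟨
      (1 Nat.+ x Nat.* p) mod p  ≡⟨ mod-cong ([m+kn]%n≡m%n 1 x p) ⟩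
      1#                         ∎)
      where open ≡-Reasoning

  nonzero⇒generates : ∀ {t} → t ≢ 0# → ∀ m → ∃ λ k → k · t ≡ m
  nonzero⇒generates {t} t≢0 m with nonzero⇒invertible t≢0
  ... | w , w*t≡1 = k , (begin
    k · t           ≡⟨ cong (k ·_) (*-identityˡ t) ⟨
    k · (1# * t)    ≡⟨ ×-assoc-* k 1# t ⟨
    (k · 1#) * t    ≡⟨ cong (_* t) (trans (·1≡mod k) (mod-toℕ (m * w))) ⟩
    (m * w) * t     ≡⟨ *-assoc m w t ⟩
    m * (w * t)     ≡⟨ cong (m *_) w*t≡1 ⟩
    m * 1#          ≡⟨ *-identityʳ m ⟩
    m               ∎)
    where
    k : ℕ
    k = toℕ (m * w)
    open ≡-Reasoning

p%4≡1⇒2<p : ∀ {p} → Prime p → p % 4 ≡ 1 → 2 < p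
p%4≡1⇒2<p {0}                 p-prime = ⊥-elim (¬prime[0] p-prime)
p%4≡1⇒2<p {1}                 p-prime = ⊥-elim (¬prime[1] p-prime)
p%4≡1⇒2<p {suc (suc (suc _))} _ _     = s≤s (s≤s (s≤s z≤n))

module GraphProperties {V : Set} (Adj : V → V → Set) where
  open GraphGroup Adj

  _++ʷ_ : ∀ {u v w} → Walk u v → Walk v w → Walk u w
  here       ++ʷ walk′ = walk′
  step a walk ++ʷ walk′ = step a (walk ++ʷ walk′)

  module _ (symmetric : ∀ u v → Adj u v → Adj v u) where

    reverseʷ : ∀ {u v} → Walk u v → Walk v u
    reverseʷ here         = here
    reverseʷ (step {u} {v} a walk) = reverseʷ walk ++ʷ step (symmetric u v a) here

    connected-from : ∀ r → (∀ v → Walk r v) → Connected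
    connected-from r walk u v = reverseʷ (walk u) ++ʷ walk v

  Neighbours : V → ℕ → Set
  Neighbours v k = Σ (List V) λ ws →
    length ws ≡ k × Unique ws × (∀ w → Adj v w ⇔ (w ∈ ws))

  neighbours-image : ∀ {k} f → IsAut f → ∀ v → Neighbours v k → Neighbours (f v) k
  neighbours-image f ((g , g∘f≗id , f∘g≗id) , f-adj) v (ws , length≡k , unique , adj⇔∈) =
    map f ws , trans (length-map f ws) length≡k , map⁺ f-injective unique ,
    λ w → mk⇔ (to w) (from w)
    where
    f-injective : ∀ {x y} → f x ≡ f y → x ≡ y
    f-injective {x} {y} e = trans (sym (g∘f≗id x)) (trans (cong g e) (g∘f≗id y))
    to : ∀ w → Adj (f v) w → w ∈ map f ws
    to w a = subst (_∈ map f ws) (f∘g≗id w) (∈-map⁺ f (Equivalence.to (adj⇔∈ (g w))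
      (Equivalence.from (f-adj v (g w)) (subst (Adj (f v)) (sym (f∘g≗id w)) a))))
    from : ∀ w → w ∈ map f ws → Adj (f v) w
    from w w∈ with ∈-map⁻ f w∈
    ... | x , x∈ws , refl = Equivalence.to (f-adj v x) (Equivalence.from (adj⇔∈ x) x∈ws)

  module GroupProperties (G : Perm → Set) where
    open OverGroup G

    ClosedUnderInverses : Set
    ClosedUnderInverses = ∀ {f} → G f → Σ Perm λ g → G g × (g ∘ f ≗ id) × (f ∘ g ≗ id)

    preserves⇒subgroupOfAut : ClosedUnderInverses →
                              (∀ {f} → G f → ∀ {u v} → Adj u v → Adj (f u) (f v)) →
                              SubgroupOfAut
    preserves⇒subgroupOfAut inverse preserves f Gf with inverse Gf
    ... | g , Gg , g∘f≗id , f∘g≗id = (g , g∘f≗id , f∘g≗id) ,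
      λ u v → mk⇔ (preserves Gf) (λ a → subst₂ Adj (g∘f≗id u) (g∘f≗id v) (preserves Gg a))

    vertexTransitive⇒regular : SubgroupOfAut → VertexTransitive → ∀ {k} v → Neighbours v k → Regular k
    vertexTransitive⇒regular aut transitive v neighbours w with transitive v w
    ... | g , Gg , refl = neighbours-image g (aut g Gg) v neighbours

    least-normal⇒socle : ∀ M → IsNormal M → Nontrivial M →
                         (∀ H → IsNormal H → Nontrivial H → ∀ f → M f → H f) →
                         ∀ f → InSoc f ⇔ M f
    least-normal⇒socle M M-normal M-nontrivial M-least f = mk⇔ socle⊆M (s-min M M-minimal)
      where
      open IsSubgroup (proj₁ M-normal)
      M-minimal : MinimalNormal M
      M-minimal = M-normal , M-nontrivial , λ K K-normal K-nontrivial _ → M-least K K-normal K-nontrivial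
      socle⊆M : ∀ {f} → InSoc f → M f
      socle⊆M (s-min M′ (M′-normal , M′-nontrivial , M′-minimal) M′f) =
        M′-minimal M M-normal M-nontrivial (M-least M′ M′-normal M′-nontrivial) _ M′f
      socle⊆M s-id = h-id
      socle⊆M (s-∘ a b) = h-∘ (socle⊆M a) (socle⊆M b)
      socle⊆M (s-inv {g = g} a g∘f≗id _) with h-inv (socle⊆M a)
      ... | g′ , Mg′ , _ , f∘g′≗id = resp Mg′ λ w → trans (sym (g∘f≗id (g′ w))) (cong g (f∘g′≗id w))
      socle⊆M (s-≗ a e) = resp (socle⊆M a) e

module PlusMinus (p : ℕ) {{nz : NonZero p}} where
  open Zmod p using (Zp)
  open ZmodRing p
  open Notation
  open CommutativeRing commutativeRing
    using (+-assoc; +-comm; +-identityˡ; *-identityˡ; *-identityʳ; -‿inverseʳ)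
  open import Algebra.Properties.Ring (CommutativeRing.ring commutativeRing)
    using (-‿involutive; -‿distribˡ-*; -‿distribʳ-*; -‿anti-homo-+; //-rightDividesˡ)

  -x*-y≡x*y : ∀ x y → - x * - y ≡ x * y
  -x*-y≡x*y x y = begin
    - x * - y      ≡⟨ -‿distribˡ-* x (- y) ⟨
    - (x * - y)    ≡⟨ cong -_ (-‿distribʳ-* x y) ⟨
    - - (x * y)    ≡⟨ -‿involutive (x * y) ⟩
    x * y          ∎
    where open ≡-Reasoning

  infix 4 _∈±_
  _∈±_ : Zp → Zp → Set
  x ∈± a = x ≡ a ⊎ x ≡ - a

  ∈±-neg : ∀ {x a} → x ∈± a → - x ∈± a
  ∈±-neg         (inj₁ refl) = inj₂ refl
  ∈±-neg {a = a} (inj₂ refl) = inj₁ (-‿involutive a)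

  ∈±-sym : ∀ {x a} → x ∈± a → a ∈± x
  ∈±-sym         (inj₁ refl) = inj₁ refl
  ∈±-sym {a = a} (inj₂ refl) = inj₂ (sym (-‿involutive a))

  ∈±-* : ∀ {x y a b} → x ∈± a → y ∈± b → x * y ∈± a * b
  ∈±-*             (inj₁ refl) (inj₁ refl) = inj₁ refl
  ∈±-* {a = a} {b} (inj₁ refl) (inj₂ refl) = inj₂ (sym (-‿distribʳ-* a b))
  ∈±-* {a = a} {b} (inj₂ refl) (inj₁ refl) = inj₂ (sym (-‿distribˡ-* a b))
  ∈±-* {a = a} {b} (inj₂ refl) (inj₂ refl) = inj₁ (-x*-y≡x*y a b)

  ∈±1⇒square≡1 : ∀ {x} → x ∈± 1# → x * x ≡ 1#
  ∈±1⇒square≡1 (inj₁ refl) = *-identityˡ 1#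
  ∈±1⇒square≡1 (inj₂ refl) = trans (-x*-y≡x*y 1# 1#) (*-identityˡ 1#)

  x*-1≡-x : ∀ x → x * - 1# ≡ - x
  x*-1≡-x x = trans (sym (-‿distribʳ-* x 1#)) (cong -_ (*-identityʳ x))

  x-[x+y]≡-y : ∀ x y → x + - (x + y) ≡ - y
  x-[x+y]≡-y x y = begin
    x + - (x + y)      ≡⟨ cong (x +_) (-‿anti-homo-+ x y) ⟩
    x + (- y + - x)    ≡⟨ +-comm x (- y + - x) ⟩
    - y + - x + x      ≡⟨ //-rightDividesˡ x (- y) ⟩
    - y                ∎
    where open ≡-Reasoning

  [x+n]-[y+n]≡x-y : ∀ x y n → x + n + - (y + n) ≡ x + - y
  [x+n]-[y+n]≡x-y x y n = begin
    x + n + - (y + n)     ≡⟨ cong (x + n +_) (-‿anti-homo-+ y n) ⟩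
    x + n + (- n + - y)   ≡⟨ +-assoc x n (- n + - y) ⟩
    x + (n + (- n + - y)) ≡⟨ cong (x +_) (+-assoc n (- n) (- y)) ⟨
    x + (n + - n + - y)   ≡⟨ cong (λ z → x + (z + - y)) (-‿inverseʳ n) ⟩
    x + (0# + - y)        ≡⟨ cong (x +_) (+-identityˡ (- y)) ⟩
    x + - y               ∎
    where open ≡-Reasoning

module AffineMaps (p : ℕ) {{nz : NonZero p}} (q : Fin p) where
  open Example p q
  open ZmodRing p

  -- solve-∀ needs a ring defined in the current (parametrised) module.
  private
    ℤₚ : AlmostCommutativeRing _ _
    ℤₚ = almostCommutativeRing
  open Notation
  open CommutativeRing commutativeRing
    using (+-comm; +-identityˡ; +-identityʳ; *-identityʳ; -‿inverseˡ; -‿inverseʳ)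

  affine : Bool → Zp → Zp → Perm
  affine b u n (x , ε) = (x * u + n , b xor ε)

  affine-∘ : ∀ b u n b′ u′ n′ →
             affine b u n ∘ affine b′ u′ n′ ≗ affine (b xor b′) (u′ * u) (n′ * u + n)
  affine-∘ b u n b′ u′ n′ (x , ε) = cong₂ _,_ (solve x u n u′ n′) (sym (xor-assoc b b′ ε))
    where
    solve : ∀ x u n u′ n′ → (x * u′ + n′) * u + n ≡ x * (u′ * u) + (n′ * u + n)
    solve = solve-∀ ℤₚ

  affine-∘-τ : ∀ b u n m → affine b u n ∘ τ m ≗ τ (m * u) ∘ affine b u n
  affine-∘-τ b u n m (x , ε) = cong (_, b xor ε) (solve x u n m)
    where
    solve : ∀ x u n m → (x + m) * u + n ≡ x * u + n + m * u
    solve = solve-∀ ℤₚ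

  τ≗affine : ∀ n → τ n ≗ affine false 1# n
  τ≗affine n (x , ε) = cong (λ y → (y + n , ε)) (sym (*-identityʳ x))

  δ≗affine : δ ≗ affine true q 0#
  δ≗affine (x , ε) = cong (_, not ε) (sym (+-identityʳ (x * q)))

  τ-+ : ∀ m n → τ (m + n) ≗ τ m ∘ τ n
  τ-+ m n (x , ε) = cong (_, ε) (solve x m n)
    where
    solve : ∀ x m n → x + (m + n) ≡ x + n + m
    solve = solve-∀ ℤₚ

  τ-0 : τ 0# ≗ id
  τ-0 (x , ε) = cong (_, ε) (+-identityʳ x)

  τ-inverseˡ : ∀ n → τ (- n) ∘ τ n ≗ id
  τ-inverseˡ n v = trans (sym (τ-+ (- n) n v)) (trans (cong (λ m → τ m v) (-‿inverseˡ n)) (τ-0 v))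

  τ-inverseʳ : ∀ n → τ n ∘ τ (- n) ≗ id
  τ-inverseʳ n v = trans (sym (τ-+ n (- n) v)) (trans (cong (λ m → τ m v) (-‿inverseʳ n)) (τ-0 v))

  τ-injective : ∀ m n → τ m ≗ τ n → m ≡ n
  τ-injective m n τm≗τn =
    trans (sym (+-identityˡ m)) (trans (cong proj₁ (τm≗τn (0# , false))) (+-identityˡ n))

  N-abelian : ∀ f g → InN f → InN g → f ∘ g ≗ g ∘ f
  N-abelian f g (m , f≗τm) (n , g≗τn) v = begin
    f (g v)       ≡⟨ trans (f≗τm (g v)) (cong (τ m) (g≗τn v)) ⟩
    τ m (τ n v)   ≡⟨ τ-+ m n v ⟨
    τ (m + n) v   ≡⟨ cong (λ k → τ k v) (+-comm m n) ⟩
    τ (n + m) v   ≡⟨ τ-+ n m v ⟩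
    τ n (τ m v)   ≡⟨ trans (g≗τn (f v)) (cong (τ n) (f≗τm v)) ⟨
    g (f v)       ∎
    where open ≡-Reasoning

module Example5p9 (p : ℕ) {{nz : NonZero p}} (p-prime : Prime p) (p%4≡1 : p % 4 ≡ 1)
                  (q : Fin p) (q*q≡-1 : Zmod._*ₚ_ p q q ≡ Zmod.-ₚ_ p (Zmod.1ₚ p)) where
  open Example p q
  open ZmodRing p
  open ZmodPrime p p-prime using (nonzero⇒generates)
  open PlusMinus p
  open AffineMaps p q
  open GraphProperties Γ
  open GroupProperties InG

  open Notation
  open CommutativeRing commutativeRing
    using ( +-assoc; +-comm; zeroˡ; +-identityˡ; +-identityʳ; *-identityˡ; *-identityʳ; *-assoc; distribʳ
          ; -‿inverseʳ )
  open import Algebra.Properties.Ring (CommutativeRing.ring commutativeRing)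
    using ( -‿involutive; -‿injective; -‿distribˡ-*; -‿distribʳ-*; -1*x≈-x; -0#≈0#; x∙y⁻¹≈ε⇒x≈y
          ; ⁻¹-anti-homo‿-; xyx⁻¹≈y; //-rightDividesˡ )

  1+1≢0 : 1# + 1# ≢ 0#
  1+1≢0 = 2<p⇒1+1≢0 (p%4≡1⇒2<p p-prime p%4≡1)

  1≢0 : 1# ≢ 0#
  1≢0 1≡0 = 1+1≢0 (trans (cong₂ _+_ 1≡0 1≡0) (+-identityˡ 0#))

  1≢-1 : 1# ≢ - 1#
  1≢-1 1≡-1 = 1+1≢0 (trans (cong (1# +_) 1≡-1) (-‿inverseʳ 1#))

  q∉±1 : ¬ q ∈± 1#
  q∉±1 q∈±1 = 1≢-1 (trans (sym (∈±1⇒square≡1 q∈±1)) q*q≡-1)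

  q≢-q : q ≢ - q
  q≢-q q≡-q = 1≢-1 (begin
    1#           ≡⟨ -‿involutive 1# ⟨
    - - 1#       ≡⟨ cong -_ q*q≡-1 ⟨
    - (q * q)    ≡⟨ -‿distribʳ-* q q ⟩
    q * - q      ≡⟨ cong (q *_) q≡-q ⟨
    q * q        ≡⟨ q*q≡-1 ⟩
    - 1#         ∎)
    where open ≡-Reasoning

  -- QPower b u : u = qᵏ for some k of parity b, i.e. δᵏ scales by u and switches the copy of N iff b.
  QPower : Bool → Zp → Set
  QPower false u = u ∈± 1#
  QPower true  u = u ∈± q

  QPower-neg : ∀ b {u} → QPower b u → QPower b (- u)
  QPower-neg false = ∈±-neg
  QPower-neg true  = ∈±-neg

  QPower-* : ∀ b b′ {u u′} → QPower b u → QPower b′ u′ → QPower (b xor b′) (u′ * u)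
  QPower-* false false {u} {u′} u∈ u′∈ = subst (u′ * u ∈±_) (*-identityˡ 1#) (∈±-* u′∈ u∈)
  QPower-* false true  {u} {u′} u∈ u′∈ = subst (u′ * u ∈±_) (*-identityʳ q) (∈±-* u′∈ u∈)
  QPower-* true  false {u} {u′} u∈ u′∈ = subst (u′ * u ∈±_) (*-identityˡ q) (∈±-* u′∈ u∈)
  QPower-* true  true            u∈ u′∈ with ∈±-* u′∈ u∈
  ... | inj₁ u′u≡qq = inj₂ (trans u′u≡qq q*q≡-1)
  ... | inj₂ u′u≡-qq = inj₁ (trans u′u≡-qq (trans (cong -_ q*q≡-1) (-‿involutive 1#)))

  QPower-1 : ∀ b → QPower b 1# → b ≡ false
  QPower-1 false _    = refl
  QPower-1 true  1∈±q = ⊥-elim (q∉±1 (∈±-sym 1∈±q))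

  S⇔QPower : ∀ x → S x ⇔ (QPower false x ⊎ QPower true x)
  S⇔QPower x = mk⇔ assocˡ assocʳ

  -- The G-invariant orientation of Γ: arcs leave N₀ along a difference ±1 and leave N₁ along ±q.
  Arc : Vertex → Vertex → Set
  Arc (h , ε) (g , ε′) = ε′ ≡ not ε × QPower ε (g + - h)

  QPower-swap : ∀ b g h → QPower b (g + - h) → QPower b (h + - g)
  QPower-swap b g h d = subst (QPower b) (⁻¹-anti-homo‿- g h) (QPower-neg b d)

  Γ⇔Arc : ∀ u v → Γ u v ⇔ (Arc u v ⊎ Arc v u)
  Γ⇔Arc (h , false) (g , false) = mk⇔ (λ ()) λ { (inj₁ (() , _)) ; (inj₂ (() , _)) }
  Γ⇔Arc (h , true)  (g , true)  = mk⇔ (λ ()) λ { (inj₁ (() , _)) ; (inj₂ (() , _)) }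
  Γ⇔Arc (h , false) (g , true)  = mk⇔
    (λ s → Sum.map (refl ,_) (λ d → refl , QPower-swap true g h d) (Equivalence.to (S⇔QPower _) s))
    λ { (inj₁ (_ , d)) → Equivalence.from (S⇔QPower _) (inj₁ d)
      ; (inj₂ (_ , d)) → Equivalence.from (S⇔QPower _) (inj₂ (QPower-swap true h g d)) }
  Γ⇔Arc (h , true)  (g , false) = mk⇔
    (λ s → Sum.swap (Sum.map (refl ,_) (λ d → refl , QPower-swap true h g d)
                                       (Equivalence.to (S⇔QPower _) s)))
    λ { (inj₁ (_ , d)) → Equivalence.from (S⇔QPower _) (inj₂ (QPower-swap true g h d))
      ; (inj₂ (_ , d)) → Equivalence.from (S⇔QPower _) (inj₁ d) }

  τ-preserves-Arc : ∀ n u v → Arc u v → Arc (τ n u) (τ n v)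
  τ-preserves-Arc n (h , ε) (g , ε′) (ε′≡¬ε , d) =
    ε′≡¬ε , subst (QPower ε) (sym ([x+n]-[y+n]≡x-y g h n)) d

  δ-preserves-Arc : ∀ u v → Arc u v → Arc (δ u) (δ v)
  δ-preserves-Arc (h , ε) (g , ε′) (ε′≡¬ε , d) =
    cong not ε′≡¬ε , subst (QPower (not ε)) (scale g h) (QPower-* true ε (inj₁ refl) d)
    where
    scale : ∀ g h → (g + - h) * q ≡ g * q + - (h * q)
    scale g h = trans (distribʳ q g (- h)) (cong (g * q +_) (sym (-‿distribˡ-* h q)))

  G-preserves-Arc : ∀ {f} → InG f → ∀ u v → Arc u v → Arc (f u) (f v)
  G-preserves-Arc g-id                 u v a = a
  G-preserves-Arc (g-τ n)              u v a = τ-preserves-Arc n u v a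
  G-preserves-Arc g-δ                  u v a = δ-preserves-Arc u v a
  G-preserves-Arc (g-∘ {f} {g} Gf Gg)  u v a = G-preserves-Arc Gf (g u) (g v) (G-preserves-Arc Gg u v a)
  G-preserves-Arc (g-≗ Gf f≗g)         u v a = subst₂ Arc (f≗g u) (f≗g v) (G-preserves-Arc Gf u v a)

  G-preserves-Γ : ∀ {f} → InG f → ∀ {u v} → Γ u v → Γ (f u) (f v)
  G-preserves-Γ {f} Gf {u} {v} a = Equivalence.from (Γ⇔Arc (f u) (f v))
    (Sum.map (G-preserves-Arc Gf u v) (G-preserves-Arc Gf v u) (Equivalence.to (Γ⇔Arc u v) a))

  δ∘δ : ∀ x ε → δ (δ (x , ε)) ≡ (- x , ε)
  δ∘δ x ε = cong₂ _,_ (trans (*-assoc x q q) (trans (cong (x *_) q*q≡-1) (x*-1≡-x x)))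
                      (not-involutive ε)

  δ-order-4 : δ ∘ δ ∘ δ ∘ δ ≗ id
  δ-order-4 (x , ε) = begin
    δ (δ (δ (δ (x , ε))))  ≡⟨ cong (δ ∘ δ) (δ∘δ x ε) ⟩
    δ (δ (- x , ε))        ≡⟨ δ∘δ (- x) ε ⟩
    (- - x , ε)            ≡⟨ cong (_, ε) (-‿involutive x) ⟩
    (x , ε)                ∎
    where open ≡-Reasoning

  G-inverse : ClosedUnderInverses
  G-inverse g-id        = id , g-id , (λ _ → refl) , (λ _ → refl)
  G-inverse (g-τ n)     = τ (- n) , g-τ (- n) , τ-inverseˡ n , τ-inverseʳ n
  G-inverse g-δ         = δ ∘ δ ∘ δ , g-∘ g-δ (g-∘ g-δ g-δ) , δ-order-4 , δ-order-4
  G-inverse (g-∘ {f} {g} Gf Gg) with G-inverse Gf | G-inverse Gg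
  ... | f⁻¹ , Gf⁻¹ , f⁻¹∘f≗id , f∘f⁻¹≗id | g⁻¹ , Gg⁻¹ , g⁻¹∘g≗id , g∘g⁻¹≗id =
    g⁻¹ ∘ f⁻¹ , g-∘ Gg⁻¹ Gf⁻¹ ,
    (λ v → trans (cong g⁻¹ (f⁻¹∘f≗id (g v))) (g⁻¹∘g≗id v)) ,
    (λ v → trans (cong f (g∘g⁻¹≗id (f⁻¹ v))) (f∘f⁻¹≗id v))
  G-inverse (g-≗ {f} {f′} Gf f≗f′) with G-inverse Gf
  ... | f⁻¹ , Gf⁻¹ , f⁻¹∘f≗id , f∘f⁻¹≗id =
    f⁻¹ , Gf⁻¹ , (λ v → trans (cong f⁻¹ (sym (f≗f′ v))) (f⁻¹∘f≗id v)) ,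
    (λ v → trans (sym (f≗f′ (f⁻¹ v))) (f∘f⁻¹≗id v))

  G≤AutΓ : SubgroupOfAut
  G≤AutΓ = preserves⇒subgroupOfAut G-inverse G-preserves-Γ

  record IsAffine (f : Perm) : Set where
    constructor affine-form
    field
      flips  : Bool
      scale  : Zp
      shift  : Zp
      qpower : QPower flips scale
      form   : f ≗ affine flips scale shift

    ∘-τ : ∀ n → f ∘ τ n ≗ τ (n * scale) ∘ f
    ∘-τ n v = begin
      f (τ n v)                              ≡⟨ form (τ n v) ⟩
      affine flips scale shift (τ n v)       ≡⟨ affine-∘-τ flips scale shift n v ⟩
      τ (n * scale) (affine flips scale shift v) ≡⟨ cong (τ (n * scale)) (form v) ⟨
      τ (n * scale) (f v)                    ∎
      where open ≡-Reasoning

  InG⇒IsAffine : ∀ {f} → InG f → IsAffine f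
  InG⇒IsAffine g-id    = affine-form false 1# 0# (inj₁ refl) λ v → trans (sym (τ-0 v)) (τ≗affine 0# v)
  InG⇒IsAffine (g-τ n) = affine-form false 1# n (inj₁ refl) (τ≗affine n)
  InG⇒IsAffine g-δ     = affine-form true q 0# (inj₁ refl) δ≗affine
  InG⇒IsAffine (g-∘ {f} {g} Gf Gg) =
    affine-form (F.flips xor G.flips) (G.scale * F.scale) (G.shift * F.scale + F.shift)
      (QPower-* F.flips G.flips F.qpower G.qpower)
      λ v → trans (F.form (g v)) (trans (cong (affine F.flips F.scale F.shift) (G.form v))
              (affine-∘ F.flips F.scale F.shift G.flips G.scale G.shift v))
    where
    module F = IsAffine (InG⇒IsAffine Gf)
    module G = IsAffine (InG⇒IsAffine Gg)
  InG⇒IsAffine (g-≗ Gf f≗g) =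
    affine-form F.flips F.scale F.shift F.qpower λ v → trans (sym (f≗g v)) (F.form v)
    where module F = IsAffine (InG⇒IsAffine Gf)

  QPower⇒InG : ∀ b {u} n → QPower b u → InG (affine b u n)
  QPower⇒InG false n (inj₁ refl) = g-≗ (g-τ n) (τ≗affine n)
  QPower⇒InG false n (inj₂ refl) = g-≗ (g-∘ (g-τ n) (g-∘ g-δ g-δ)) λ { (x , ε) →
    trans (cong (τ n) (δ∘δ x ε)) (cong (λ y → (y + n , ε)) (sym (x*-1≡-x x))) }
  QPower⇒InG true  n (inj₁ refl) = g-∘ (g-τ n) g-δ
  QPower⇒InG true  n (inj₂ refl) = g-≗ (g-∘ (g-τ n) (g-∘ g-δ (g-∘ g-δ g-δ))) λ { (x , ε) →
    trans (cong (τ n) (δ∘δ (x * q) (not ε))) (cong (λ y → (y + n , not ε)) (-‿distribʳ-* x q)) }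

  A₀ B₀ : Vertex
  A₀ = (0# , false)
  B₀ = (1# , true)

  arc-from-base : ∀ u v → Arc u v → Σ Perm λ g → InG g × g A₀ ≡ u × g B₀ ≡ v
  arc-from-base (h , ε) (g , ε′) (ε′≡¬ε , d) =
    affine ε (g + - h) h , QPower⇒InG ε h d ,
    cong₂ _,_ (trans (cong (_+ h) (zeroˡ (g + - h))) (+-identityˡ h)) (xor-identityʳ ε) ,
    cong₂ _,_ (trans (cong (_+ h) (*-identityˡ (g + - h))) (//-rightDividesˡ h g))
              (trans (xor-comm ε true) (sym ε′≡¬ε))

  arc-transitive : ∀ {u v u′ v′} → Arc u v → Arc u′ v′ → Σ Perm λ g → InG g × g u ≡ u′ × g v ≡ v′
  arc-transitive {u} {v} {u′} {v′} a a′ =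
    let g  , Gg  , gA₀≡u  , gB₀≡v  = arc-from-base u v a
        g′ , Gg′ , g′A₀≡u′ , g′B₀≡v′ = arc-from-base u′ v′ a′
        g⁻¹ , Gg⁻¹ , g⁻¹∘g≗id , _  = G-inverse Gg
        via : ∀ x {y z} → g x ≡ y → g′ x ≡ z → g′ (g⁻¹ y) ≡ z
        via x gx≡y g′x≡z = trans (cong (g′ ∘ g⁻¹) (sym gx≡y)) (trans (cong g′ (g⁻¹∘g≗id x)) g′x≡z)
    in g′ ∘ g⁻¹ , g-∘ Gg′ Gg⁻¹ , via A₀ gA₀≡u g′A₀≡u′ , via B₀ gB₀≡v g′B₀≡v′

  out-arc : ∀ u → Σ Vertex (Arc u)
  out-arc (h , false) = (h + 1# , true)  , refl , inj₁ (xyx⁻¹≈y h 1#)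
  out-arc (h , true)  = (h + q , false)  , refl , inj₁ (xyx⁻¹≈y h q)

  vertex-transitive : VertexTransitive
  vertex-transitive u v =
    let g , Gg , gu≡v , _ = arc-transitive (proj₂ (out-arc u)) (proj₂ (out-arc v)) in g , Gg , gu≡v

  edge-transitive : EdgeTransitive
  edge-transitive u v u′ v′ e e′ =
    orient (Equivalence.to (Γ⇔Arc u v) e) (Equivalence.to (Γ⇔Arc u′ v′) e′)
    where
    orient : Arc u v ⊎ Arc v u → Arc u′ v′ ⊎ Arc v′ u′ →
             Σ Perm λ g → InG g × ((g u ≡ u′ × g v ≡ v′) ⊎ (g u ≡ v′ × g v ≡ u′))
    orient (inj₁ uv) (inj₁ u′v′) = Σ.map₂ (Σ.map₂ inj₁) (arc-transitive uv u′v′)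
    orient (inj₁ uv) (inj₂ v′u′) = Σ.map₂ (Σ.map₂ inj₂) (arc-transitive uv v′u′)
    orient (inj₂ vu) (inj₁ u′v′) = Σ.map₂ (Σ.map₂ (inj₂ ∘ Σ.swap)) (arc-transitive vu u′v′)
    orient (inj₂ vu) (inj₂ v′u′) = Σ.map₂ (Σ.map₂ (inj₁ ∘ Σ.swap)) (arc-transitive vu v′u′)

  A₀→B₀ : Arc A₀ B₀
  A₀→B₀ = refl , inj₁ (trans (cong (1# +_) -0#≈0#) (+-identityʳ 1#))

  B₀↛A₀ : ¬ Arc B₀ A₀
  B₀↛A₀ (_ , d) = true≢false (QPower-1 true (subst (QPower true) 0-1≡-1 (QPower-neg true d)))
    where
    true≢false : true ≢ false
    true≢false ()
    0-1≡-1 : - (0# + - 1#) ≡ 1#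
    0-1≡-1 = trans (cong -_ (+-identityˡ (- 1#))) (-‿involutive 1#)

  not-arc-transitive : ¬ ArcTransitive
  not-arc-transitive arc-transitive =
    let g , Gg , gA₀≡B₀ , gB₀≡A₀ = arc-transitive A₀ B₀ B₀ A₀
                                     (Equivalence.from (Γ⇔Arc A₀ B₀) (inj₁ A₀→B₀))
                                     (Equivalence.from (Γ⇔Arc B₀ A₀) (inj₂ A₀→B₀))
    in B₀↛A₀ (subst₂ Arc gA₀≡B₀ gB₀≡A₀ (G-preserves-Arc Gg A₀ B₀ A₀→B₀))

  Γ-symmetric : ∀ u v → Γ u v → Γ v u
  Γ-symmetric (_ , false) (_ , true)  a = a
  Γ-symmetric (_ , true)  (_ , false) a = a

  two-steps : ∀ h → Walk (h , false) (h + 1# + 1# , false)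
  two-steps h = step {v = h + 1# , true} (inj₁ (xyx⁻¹≈y h 1#))
                     (step (inj₂ (inj₁ (x-[x+y]≡-y (h + 1#) 1#))) here)

  walk-to-even : ∀ k → Walk A₀ (k · (1# + 1#) , false)
  walk-to-even zero    = here
  walk-to-even (suc k) =
    walk-to-even k ++ʷ
    subst (λ x → Walk (k · two , false) (x , false)) shift-by-two (two-steps (k · two))
    where
    two : Zp
    two = 1# + 1#
    shift-by-two : k · two + 1# + 1# ≡ two + k · two
    shift-by-two = trans (+-assoc (k · two) 1# 1#) (+-comm (k · two) two)

  reach-N₀ : ∀ y → Walk A₀ (y , false)
  reach-N₀ y = let k , k·2≡y = nonzero⇒generates 1+1≢0 y in
    subst (λ x → Walk A₀ (x , false)) k·2≡y (walk-to-even k)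

  reach : ∀ v → Walk A₀ v
  reach (y , false) = reach-N₀ y
  reach (y , true)  = reach-N₀ (y + - 1#) ++ʷ step {v = y , true} (inj₁ y-[y-1]≡1) here
    where
    y-[y-1]≡1 : y + - (y + - 1#) ≡ 1#
    y-[y-1]≡1 = trans (x-[x+y]≡-y y (- 1#)) (-‿involutive 1#)

  connected : Connected
  connected = connected-from Γ-symmetric A₀ reach

  neighbours-A₀ : Neighbours A₀ 4
  neighbours-A₀ = ws , refl , unique , Γ⇔∈
    where
    ws : List Vertex
    ws = (1# , true) ∷ (- 1# , true) ∷ (q , true) ∷ (- q , true) ∷ []

    in-N₁ : ∀ {x y} → x ≢ y → (x , true) ≢ (y , true)
    in-N₁ x≢y e = x≢y (cong proj₁ e)

    unique : Unique ws
    unique = (in-N₁ 1≢-1 ∷ in-N₁ (λ e → q∉±1 (inj₁ (sym e))) ∷ in-N₁ (λ e → q∉±1 (∈±-sym (inj₂ e))) ∷ [])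
           ∷ (in-N₁ (λ e → q∉±1 (inj₂ (sym e))) ∷ in-N₁ (λ e → q∉±1 (inj₁ (-‿injective (sym e)))) ∷ [])
           ∷ (in-N₁ q≢-q ∷ [])
           ∷ [] ∷ []

    S→∈ : ∀ {g} → S g → (g , true) ∈ ws
    S→∈ (inj₁ refl)               = here refl
    S→∈ (inj₂ (inj₁ refl))        = there (here refl)
    S→∈ (inj₂ (inj₂ (inj₁ refl))) = there (there (here refl))
    S→∈ (inj₂ (inj₂ (inj₂ refl))) = there (there (there (here refl)))

    ∈→S : ∀ {g} → (g , true) ∈ ws → S g
    ∈→S (here refl)                         = inj₁ refl
    ∈→S (there (here refl))                 = inj₂ (inj₁ refl)
    ∈→S (there (there (here refl)))         = inj₂ (inj₂ (inj₁ refl))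
    ∈→S (there (there (there (here refl)))) = inj₂ (inj₂ (inj₂ refl))

    g-0≡g : ∀ g → g + - 0# ≡ g
    g-0≡g g = trans (cong (g +_) -0#≈0#) (+-identityʳ g)

    Γ⇔∈ : ∀ w → Γ A₀ w ⇔ (w ∈ ws)
    Γ⇔∈ (g , false) = mk⇔ (λ ()) λ
      { (here ()) ; (there (here ())) ; (there (there (here ()))) ; (there (there (there (here ())))) }
    Γ⇔∈ (g , true)  = mk⇔ (λ s → S→∈ (subst S (g-0≡g g) s)) (λ w∈ → subst S (sym (g-0≡g g)) (∈→S w∈))

  Γ-regular : Regular 4
  Γ-regular = vertexTransitive⇒regular G≤AutΓ vertex-transitive A₀ neighbours-A₀

  N-subgroup : IsSubgroup InN
  N-subgroup = record
    { sub   = λ (n , f≗τn) → g-≗ (g-τ n) λ v → sym (f≗τn v)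
    ; resp  = λ (n , f≗τn) f≗g → n , λ v → trans (sym (f≗g v)) (f≗τn v)
    ; h-id  = 0# , λ v → sym (τ-0 v)
    ; h-∘   = λ {f} {g} (m , f≗τm) (n , g≗τn) →
                m + n , λ v → trans (f≗τm (g v)) (trans (cong (τ m) (g≗τn v)) (sym (τ-+ m n v)))
    ; h-inv = λ (n , f≗τn) → τ (- n) , (- n , λ _ → refl) ,
                (λ v → trans (cong (τ (- n)) (f≗τn v)) (τ-inverseˡ n v)) ,
                (λ v → trans (f≗τn (τ (- n) v)) (τ-inverseʳ n v))
    }

  N-normal : IsNormal InN
  N-normal = N-subgroup , λ g g′ f Gg _ _ g∘g′≗id (n , f≗τn) → n * IsAffine.scale (InG⇒IsAffine Gg) ,
    λ w → trans (cong g (f≗τn (g′ w)))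
            (trans (IsAffine.∘-τ (InG⇒IsAffine Gg) n (g′ w)) (cong (τ _) (g∘g′≗id w)))

  N-nontrivial : Nontrivial InN
  N-nontrivial = τ 1# , (1# , λ _ → refl) ,
    λ τ1≗id → 1≢0 (τ-injective 1# 0# λ v → trans (τ1≗id v) (sym (τ-0 v)))

  normal⇒nonzero-translation : ∀ H → IsNormal H → Nontrivial H → ∃ λ t → t ≢ 0# × H (τ t)
  normal⇒nonzero-translation H (H-subgroup , H-normal) (f , Hf , f≉id) =
    from-affine (InG⇒IsAffine (sub Hf))
    where
    open IsSubgroup H-subgroup
    from-affine : IsAffine f → ∃ λ t → t ≢ 0# × H (τ t)
    from-affine (affine-form b u n qp f≗aff) with u ≟ 1#
    ... | yes refl with QPower-1 b qp
    ...   | refl = n , n≢0 , resp Hf f≗τn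
      where
      f≗τn : f ≗ τ n
      f≗τn v = trans (f≗aff v) (sym (τ≗affine n v))
      n≢0 : n ≢ 0#
      n≢0 refl = f≉id λ v → trans (f≗τn v) (τ-0 v)
    from-affine F@(affine-form b u n qp f≗aff) | no u≢1 with h-inv Hf
    ... | f⁻¹ , Hf⁻¹ , _ , f∘f⁻¹≗id =
      1# + - u , (λ 1-u≡0 → u≢1 (sym (x∙y⁻¹≈ε⇒x≈y 1# u 1-u≡0))) ,
      resp (h-∘ (H-normal (τ 1#) (τ (- 1#)) f (g-τ 1#) (g-τ (- 1#)) (τ-inverseˡ 1#) (τ-inverseʳ 1#) Hf)
                Hf⁻¹)
           commutator
      where
      commutator : τ 1# ∘ f ∘ τ (- 1#) ∘ f⁻¹ ≗ τ (1# + - u)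
      commutator w = begin
        τ 1# (f (τ (- 1#) (f⁻¹ w)))        ≡⟨ cong (τ 1#) (IsAffine.∘-τ F (- 1#) (f⁻¹ w)) ⟩
        τ 1# (τ (- 1# * u) (f (f⁻¹ w)))    ≡⟨ cong (τ 1# ∘ τ (- 1# * u)) (f∘f⁻¹≗id w) ⟩
        τ 1# (τ (- 1# * u) w)              ≡⟨ τ-+ 1# (- 1# * u) w ⟨
        τ (1# + - 1# * u) w                ≡⟨ cong (λ t → τ (1# + t) w) (-1*x≈-x u) ⟩
        τ (1# + - u) w                     ∎
        where open ≡-Reasoning

  normal⇒N⊆ : ∀ H → IsNormal H → Nontrivial H → ∀ f → InN f → H f
  normal⇒N⊆ H H-normal H-nontrivial f (n , f≗τn) =
    let k , k·t≡n = nonzero⇒generates t≢0 n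
    in resp (multiples k) λ v → trans (cong (λ m → τ m v) k·t≡n) (sym (f≗τn v))
    where
    open IsSubgroup (proj₁ H-normal)
    t-nonzero : ∃ λ t → t ≢ 0# × H (τ t)
    t-nonzero = normal⇒nonzero-translation H H-normal H-nontrivial
    t : Zp
    t = proj₁ t-nonzero
    t≢0 : t ≢ 0#
    t≢0 = proj₁ (proj₂ t-nonzero)
    multiples : ∀ k → H (τ (k · t))
    multiples zero    = resp h-id λ v → sym (τ-0 v)
    multiples (suc k) = resp (h-∘ (proj₂ (proj₂ t-nonzero)) (multiples k)) λ v → sym (τ-+ t (k · t) v)

  N⊆⇒atMostTwoOrbits : ∀ H → (∀ m → H (τ m)) → AtMostTwoOrbits H
  N⊆⇒atMostTwoOrbits H Hτ = (0# , false) , (0# , true) , λ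
    { (y , false) → inj₁ (τ y , Hτ y , cong (_, false) (+-identityˡ y))
    ; (y , true)  → inj₂ (τ y , Hτ y , cong (_, true) (+-identityˡ y)) }

  N-intransitive : ¬ OneOrbit InN
  N-intransitive ((x , ε) , orbit) =
    let h , (n , h≗τn) , h[x,ε]≡[x,¬ε] = orbit (x , not ε)
    in not-¬ refl (cong proj₂ (trans (sym (h≗τn (x , ε))) h[x,ε]≡[x,¬ε]))

  basic : BasicBiquasiprimitive
  basic = (λ H H-normal H-nontrivial →
             N⊆⇒atMostTwoOrbits H λ m → normal⇒N⊆ H H-normal H-nontrivial (τ m) (m , λ _ → refl))
        , InN , N-normal , N-nontrivial , N⊆⇒atMostTwoOrbits InN (λ m → m , λ _ → refl) , N-intransitive

  socle≡N : ∀ f → InSoc f ⇔ InN f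
  socle≡N = least-normal⇒socle InN N-normal N-nontrivial normal⇒N⊆

lemma5p9 : (p : ℕ) {{nz : NonZero p}} → Prime p → p % 4 ≡ 1 →
    (q : Fin p) →
    let open Example p q in
    q *ₚ q ≡ -ₚ 1ₚ →
    Connected
    × Regular 4
    × SubgroupOfAut
    × Oriented
    × BasicBiquasiprimitive
    × (∀ f → InSoc f ⇔ InN f)
    × IsNormal InN
    × (∀ m n → τ (m +ₚ n) ≗ τ m ∘ τ n)
    × (∀ m n → τ m ≗ τ n → m ≡ n)
    × (∀ f g → InN f → InN g → f ∘ g ≗ g ∘ f)
lemma5p9 p p-prime p%4≡1 q q*q≡-1 =
  connected , Γ-regular , G≤AutΓ , (vertex-transitive , edge-transitive , not-arc-transitive) ,
  basic , socle≡N , N-normal , τ-+ , τ-injective , N-abelian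
  where
  open AffineMaps p q
  open Example5p9 p p-prime p%4≡1 q q*q≡-1
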